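{- For every unimodal formula $\phi$: $\phi\in\mathbf{KDe}$ if and only if for all $(a_1,\ldots,a_{n_\phi})\in W_\phi^{k_\phi}$, $a_{n_\phi}=1$.
   Context: Unimodal formulas are built from atoms, $\bot$, $\neg$, $\vee$ and $\square$. $\mathbf{KDe}$ is the least normal modal logic containing $\square\square p\rightarrow\square p$ (the logic of dense frames). Fix a formula $\phi$; let $\Sigma_\phi$ be its set of subformulas, $n_\phi=|\Sigma_\phi|$, and $(\psi_1,\ldots,\psi_{n_\phi})$ an enumeration of $\Sigma_\phi$ such that if $\psi_i=\neg\psi_j$ or $\psi_i=\square\psi_j$ then $i>j$, and if $\psi_i=\psi_j\vee\psi_k$ then $i>j,k$ (so $\psi_{n_\phi}=\phi$). A $\phi$-tip is a tuple $(a_1,\ldots,a_{n_\phi})\in\{0,1\}^{n_\phi}$ such that $a_i=0$ if $\psi_i=\bot$, $a_i=1-a_j$ if $\psi_i=\neg\psi_j$, $a_i=\max\{a_j,a_k\}$ if $\psi_i=\psi_j\vee\psi_k$. $W_\phi^0$ is the set of all $\phi$-tips and $R_\phi^0$ relates $a$ to $b$ iff for all $i,j$, if $\psi_i=\square\psi_j$ and $a_i=1$ then $b_j=1$. For $(W,R)$ with $W\subseteq W_\phi^0$, $\sigma_\phi(W,R)=(W',R')$ where $W'$ is the set of $a\in W$ such that for all $i,j$ with $\psi_i=\square\psi_j$ and $a_i=0$ there is $b\in W$ with $aRb$ and $b_j=0$; and for $a,b\in W'$, $aR'b$ iff $aRb$ and there is $c\in W$ with $aRc$ and $cRb$. $k_\phi$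 is the least $k$ with $\sigma_\phi^{k+1}(W_\phi^0,R_\phi^0)=\sigma_\phi^k(W_\phi^0,R_\phi^0)$, and $(W_\phi^{k_\phi},R_\phi^{k_\phi})=\sigma_\phi^{k_\phi}(W_\phi^0,R_\phi^0)$. -}

module Defs where

open import Data.Nat using (ℕ; suc)
open import Data.Bool using (Bool; true; false; not; _∨_)
open import Data.Fin using (Fin; _<_)
open import Data.Product using (Σ; _×_; ∃; ∃-syntax)
open import Relation.Binary.PropositionalEquality using (_≡_)
open import Relation.Nullary using (¬_)
open import Function.Bundles using (_⇔_)
open import Function.Definitions using (Injective)

infixr 5 _∨'_
infixr 4 _⇒_

data Fm : Set where
  var  : ℕ → Fm
  ⊥'   : Fm
  ¬'   : Fm → Fm
  _∨'_ : Fm → Fm → Fm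
  □    : Fm → Fm

_⇒_ : Fm → Fm → Fm
a ⇒ b = ¬' a ∨' b

evalP : (Fm → Bool) → Fm → Bool
evalP v (var p)  = v (var p)
evalP v ⊥'       = false
evalP v (¬' a)   = not (evalP v a)
evalP v (a ∨' b) = evalP v a ∨ evalP v b
evalP v (□ a)    = v (□ a)

-- substitution instances of classical propositional tautologies
Taut : Fm → Set
Taut a = ∀ (v : Fm → Bool) → evalP v a ≡ true

-- KDe: least normal modal logic containing □□p → □p
-- (all instances of tautologies, K and the density axiom; closed under MP and
-- necessitation; closure under uniform substitution is built in by using schemata)
data KDe : Fm → Set where
  taut : ∀ {a} → Taut a → KDe a
  axK  : ∀ {a b} → KDe (□ (a ⇒ b) ⇒ (□ a ⇒ □ b))
  axDe : ∀ {a} → KDe (□ (□ a) ⇒ □ a)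
  mp   : ∀ {a b} → KDe (a ⇒ b) → KDe a → KDe b
  nec  : ∀ {a} → KDe a → KDe (□ a)

data _≼_ : Fm → Fm → Set where
  here : ∀ {a} → a ≼ a
  in¬  : ∀ {a b} → a ≼ b → a ≼ ¬' b
  in∨ˡ : ∀ {a b c} → a ≼ b → a ≼ (b ∨' c)
  in∨ʳ : ∀ {a b c} → a ≼ c → a ≼ (b ∨' c)
  in□  : ∀ {a b} → a ≼ b → a ≼ □ b

record IsEnum (φ : Fm) {n : ℕ} (e : Fin n → Fm) : Set where
  field
    injective : Injective _≡_ _≡_ e
    sound     : ∀ i → e i ≼ φ
    complete  : ∀ ψ → ψ ≼ φ → ∃[ i ] (e i ≡ ψ)
    ord¬      : ∀ i j → e i ≡ ¬' (e j) → j < i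
    ord□      : ∀ i j → e i ≡ □ (e j) → j < i
    ord∨      : ∀ i j k → e i ≡ (e j ∨' e k) → (j < i) × (k < i)

module _ {n : ℕ} (e : Fin n → Fm) where

  -- tuples in {0,1}^n (0 = false, 1 = true)
  Tuple : Set
  Tuple = Fin n → Bool

  IsTip : Tuple → Set
  IsTip a = ∀ i →
      (e i ≡ ⊥' → a i ≡ false)
    × (∀ j → e i ≡ ¬' (e j) → a i ≡ not (a j))
    × (∀ j k → e i ≡ (e j ∨' e k) → a i ≡ (a j ∨ a k))

  record Frame : Set₁ where
    field
      W : Tuple → Set
      R : Tuple → Tuple → Set
  open Frame public

  -- (W⁰, R⁰); R is taken as a relation on W
  R0 : Tuple → Tuple → Set
  R0 a b = IsTip a × IsTip b ×
           (∀ i j → e i ≡ □ (e j) → a i ≡ true → b j ≡ true)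

  F0 : Frame
  F0 = record { W = IsTip ; R = R0 }

  σ : Frame → Frame
  σ F = record { W = W' ; R = R' }
    where
    W' : Tuple → Set
    W' a = W F a ×
           (∀ i j → e i ≡ □ (e j) → a i ≡ false →
              ∃[ b ] (W F b × R F a b × b j ≡ false))
    R' : Tuple → Tuple → Set
    R' a b = W' a × W' b × R F a b × ∃[ c ] (W F c × R F a c × R F c b)

  stage : ℕ → Frame
  stage 0       = F0
  stage (suc k) = σ (stage k)

  _≈F_ : Frame → Frame → Set
  F ≈F G = (∀ a → W F a ⇔ W G a) × (∀ a b → R F a b ⇔ R G a b)

  Stable : ℕ → Set
  Stable k = stage (suc k) ≈F stage k

  IsLeastStable : ℕ → Set
  IsLeastStable k = Stable k × (∀ k' → k' Data.Nat.< k → ¬ Stable k')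

-- The stages shrink, W^{k+1} ⊆ W^k and R^{k+1} ⊆ R^k, so the number of points plus arrows is a
-- non-increasing natural number, constant exactly at the fixed points of σ; hence a least fixed
-- point k exists and is found by a decidable search.
--
-- Soundness: at a fixed point every arrow a R^k b has a midpoint in W^k, so the finite model on W^k
-- (atom p true at a iff a_i = 1 for some ψ_i = p) is dense and validates KDe. Its points are tips,
-- and the W-clause of σ provides for every false boxed ψ_i a successor refuting its body, so a point
-- a satisfies ψ_i iff a_i = 1.
--
-- Completeness: let χ_a be the conjunction of the literals ±ψ_i chosen by a. By induction on k,
-- KDe ⊢ ¬χ_a for a ∉ W^k and KDe ⊢ χ_a → □¬χ_b for (a, b) ∉ R^k; the R-step is where □□p → □p
-- is used. Since the χ_a exhaust all valuations, if a_n = 1 on all of W^k then every χ_a implies φ,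
-- and φ is a theorem.

module Submission where

open import Defs
open import Data.Bool as Bool using (Bool; true; false; not; _∧_; _∨_)
open import Data.Bool.Properties using (∧-conicalˡ; ∧-conicalʳ; ¬-not; not-¬)
open import Data.Fin as Fin using (Fin; zero; suc; fromℕ)
open import Data.Fin.Properties as Fin using (all?; any?; ¬∀⟶∃¬)
open import Data.Nat as ℕ using (ℕ; zero; suc; _+_; _≤_; _<_; z≤n; s≤s)
open import Data.Nat.Properties as ℕ using ()
open import Data.Product using (_×_; _,_; proj₁; proj₂; ∃; ∃-syntax)
open import Data.Sum using (_⊎_; inj₁; inj₂; [_,_])
open import Data.List using (List; []; _∷_)
open import Data.List.Relation.Unary.All using (All; []; _∷_)
open import Data.Vec.Functional using (Vector; head; tail; foldr) renaming (_∷_ to _∷ᵇ_)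
open import Data.Vec.Functional.Properties using (∷-cong)
open import Function using (_∘_; _$_; case_of_)
open import Function.Bundles using (_⇔_; mk⇔; Equivalence)
open import Relation.Binary.Core using (_Preserves_⟶_)
open import Relation.Binary.Definitions using (DecidableEquality; _Respects_)
open import Relation.Binary.PropositionalEquality using (_≡_; _≢_; _≗_; refl; sym; trans; cong; cong₂; subst)
open import Relation.Nullary using (¬_; Dec; yes; no; does; contradiction)
open import Relation.Nullary.Decidable using (map′; _×-dec_; _→-dec_; dec-true; dec-false; does-⇔)
open import Relation.Unary using (Decidable)

open Equivalence using (to; from)

var-injective : ∀ {p q} → var p ≡ var q → p ≡ q
var-injective refl = refl

¬'-injective : ∀ {a b} → ¬' a ≡ ¬' b → a ≡ b
¬'-injective refl = refl

∨'-injective : ∀ {a b c d} → a ∨' b ≡ c ∨' d → a ≡ c × b ≡ d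
∨'-injective refl = refl , refl

□-injective : ∀ {a b} → □ a ≡ □ b → a ≡ b
□-injective refl = refl

infix 4 _≟_
_≟_ : DecidableEquality Fm
var p    ≟ var q    = map′ (cong var) var-injective (p ℕ.≟ q)
⊥'       ≟ ⊥'       = yes refl
¬' a     ≟ ¬' b     = map′ (cong ¬') ¬'-injective (a ≟ b)
(a ∨' b) ≟ (c ∨' d) = map′ (λ (p , q) → cong₂ _∨'_ p q) ∨'-injective (a ≟ c ×-dec b ≟ d)
□ a      ≟ □ b      = map′ (cong □) □-injective (a ≟ b)
var _    ≟ ⊥'       = no λ ()
var _    ≟ ¬' _     = no λ ()
var _    ≟ _ ∨' _   = no λ ()
var _    ≟ □ _      = no λ ()
⊥'       ≟ var _    = no λ ()
⊥'       ≟ ¬' _     = no λ ()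
⊥'       ≟ _ ∨' _   = no λ ()
⊥'       ≟ □ _      = no λ ()
¬' _     ≟ var _    = no λ ()
¬' _     ≟ ⊥'       = no λ ()
¬' _     ≟ _ ∨' _   = no λ ()
¬' _     ≟ □ _      = no λ ()
_ ∨' _   ≟ var _    = no λ ()
_ ∨' _   ≟ ⊥'       = no λ ()
_ ∨' _   ≟ ¬' _     = no λ ()
_ ∨' _   ≟ □ _      = no λ ()
□ _      ≟ var _    = no λ ()
□ _      ≟ ⊥'       = no λ ()
□ _      ≟ ¬' _     = no λ ()
□ _      ≟ _ ∨' _   = no λ ()

≼-trans : ∀ {a b c} → a ≼ b → b ≼ c → a ≼ c
≼-trans p here     = p
≼-trans p (in¬ q)  = in¬ (≼-trans p q)
≼-trans p (in∨ˡ q) = in∨ˡ (≼-trans p q)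
≼-trans p (in∨ʳ q) = in∨ʳ (≼-trans p q)
≼-trans p (in□ q)  = in□ (≼-trans p q)

Bits : ℕ → Set
Bits = Vector Bool

∷-η : ∀ {n} (t : Bits (suc n)) → t ≗ head t ∷ᵇ tail t
∷-η t = ∷-cong refl (λ _ → refl)

module _ {A : Set} (_•_ : A → A → A) where

  foldBits : ∀ {n} → (Bits n → A) → A
  foldBits {zero}  f = f (λ ())
  foldBits {suc n} f = foldBits (f ∘ (true ∷ᵇ_)) • foldBits (f ∘ (false ∷ᵇ_))

  foldBits-rel : (_∼_ : A → A → Set) → (∀ {x y x' y'} → x ∼ x' → y ∼ y' → (x • y) ∼ (x' • y')) →
                 ∀ {n} {f g : Bits n → A} → (∀ t → f t ∼ g t) → foldBits f ∼ foldBits g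
  foldBits-rel _∼_ •-mono {zero}  f∼g = f∼g _
  foldBits-rel _∼_ •-mono {suc n} f∼g =
    •-mono (foldBits-rel _∼_ •-mono (f∼g ∘ (true ∷ᵇ_))) (foldBits-rel _∼_ •-mono (f∼g ∘ (false ∷ᵇ_)))

  foldBits-intro : (P : A → Set) → (∀ {x y} → P x → P y → P (x • y)) →
                   ∀ {n} {f : Bits n → A} → (∀ t → P (f t)) → P (foldBits f)
  foldBits-intro P •-intro {zero}  Pf = Pf _
  foldBits-intro P •-intro {suc n} Pf =
    •-intro (foldBits-intro P •-intro (Pf ∘ (true ∷ᵇ_))) (foldBits-intro P •-intro (Pf ∘ (false ∷ᵇ_)))

  foldBits-elim : (P : A → Set) → (∀ {x y} → P (x • y) → P x × P y) →
                  ∀ {n} {f : Bits n → A} → f Preserves _≗_ ⟶ _≡_ → P (foldBits f) → ∀ t → P (f t)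
  foldBits-elim P •-elim {zero}  f-resp Pf t = subst P (f-resp λ ()) Pf
  foldBits-elim P •-elim {suc n} {f} f-resp Pf t = subst P (sym (f-resp (∷-η t))) (split (head t) (tail t))
    where
    split : ∀ x s → P (f (x ∷ᵇ s))
    split true  = foldBits-elim P •-elim (f-resp ∘ ∷-cong refl) (proj₁ (•-elim Pf))
    split false = foldBits-elim P •-elim (f-resp ∘ ∷-cong refl) (proj₂ (•-elim Pf))

allBits : ∀ {n} → (Bits n → Bool) → Bool
allBits = foldBits _∧_

allBits-intro : ∀ {n} {f : Bits n → Bool} → (∀ t → f t ≡ true) → allBits f ≡ true
allBits-intro = foldBits-intro _∧_ (_≡ true) λ { refl refl → refl }

allBits-elim : ∀ {n} {f : Bits n → Bool} → f Preserves _≗_ ⟶ _≡_ → allBits f ≡ true → ∀ t → f t ≡ true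
allBits-elim = foldBits-elim _∧_ (_≡ true) λ {x} {y} xy → ∧-conicalˡ x y xy , ∧-conicalʳ x y xy

sumBits : ∀ {n} → (Bits n → ℕ) → ℕ
sumBits = foldBits _+_

+-≤-≡-split : ∀ {a b c d} → a ≤ c → b ≤ d → a + b ≡ c + d → a ≡ c × b ≡ d
+-≤-≡-split {a} {b} {c} {d} a≤c b≤d eq = a≡c , ℕ.+-cancelˡ-≡ a b d (trans eq (cong (_+ d) (sym a≡c)))
  where
  a≡c : a ≡ c
  a≡c = ℕ.≤-antisym a≤c (ℕ.+-cancelʳ-≤ b c a (subst (c + b ≤_) (sym eq) (ℕ.+-monoʳ-≤ c b≤d)))

sumBits-mono : ∀ {n} {f g : Bits n → ℕ} → (∀ t → f t ≤ g t) → sumBits f ≤ sumBits g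
sumBits-mono = foldBits-rel _+_ _≤_ ℕ.+-mono-≤

sumBits-cong : ∀ {n} {f g : Bits n → ℕ} → (∀ t → f t ≡ g t) → sumBits f ≡ sumBits g
sumBits-cong = foldBits-rel _+_ _≡_ (cong₂ _+_)

sumBits-≤-≡ : ∀ {n} {f g : Bits n → ℕ} → f Preserves _≗_ ⟶ _≡_ → g Preserves _≗_ ⟶ _≡_ →
              (∀ t → f t ≤ g t) → sumBits f ≡ sumBits g → ∀ t → f t ≡ g t
sumBits-≤-≡ {zero} f-resp g-resp f≤g eq t = trans (f-resp λ ()) (trans eq (g-resp λ ()))
sumBits-≤-≡ {suc n} {f} {g} f-resp g-resp f≤g eq t =
  trans (f-resp (∷-η t)) (trans (split (head t) (tail t)) (sym (g-resp (∷-η t))))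
  where
  halves = +-≤-≡-split (sumBits-mono (f≤g ∘ (true ∷ᵇ_))) (sumBits-mono (f≤g ∘ (false ∷ᵇ_))) eq
  split : ∀ x s → f (x ∷ᵇ s) ≡ g (x ∷ᵇ s)
  split true  = sumBits-≤-≡ (f-resp ∘ ∷-cong refl) (g-resp ∘ ∷-cong refl) (f≤g ∘ (true ∷ᵇ_)) (proj₁ halves)
  split false = sumBits-≤-≡ (f-resp ∘ ∷-cong refl) (g-resp ∘ ∷-cong refl) (f≤g ∘ (false ∷ᵇ_)) (proj₂ halves)

anyBits? : ∀ {n} {P : Bits n → Set} → P Respects _≗_ → Decidable P → Dec (∃ P)
anyBits? {zero}  P-resp P? = map′ (λ p → _ , p) (λ (t , p) → P-resp (λ ()) p) (P? λ ())
anyBits? {suc n} {P} P-resp P? with anyBits? (P-resp ∘ ∷-cong refl) (P? ∘ (true ∷ᵇ_))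
                                  | anyBits? (P-resp ∘ ∷-cong refl) (P? ∘ (false ∷ᵇ_))
... | yes (s , p) | _           = yes (_ , p)
... | no _        | yes (s , p) = yes (_ , p)
... | no ¬true    | no ¬false   = no λ (t , p) → none (head t) (tail t) (P-resp (∷-η t) p)
  where
  none : ∀ x s → ¬ P (x ∷ᵇ s)
  none true  s p = ¬true (s , p)
  none false s p = ¬false (s , p)

-- The stages stabilise

stationary : (f : ℕ → ℕ) → (∀ k → f (suc k) ≤ f k) → ∃[ k ] f (suc k) ≡ f k
stationary f f-anti = search 0 (f 0) ℕ.≤-refl
  where
  search : ∀ k bound → f k ≤ bound → ∃[ k ] f (suc k) ≡ f k
  search k bound fk≤bound with f (suc k) ℕ.≟ f k
  ... | yes eq  = k , eq
  ... | no  neq with bound | ℕ.<-≤-trans (ℕ.≤∧≢⇒< (f-anti k) neq) fk≤bound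
  ...   | zero       | ()
  ...   | suc bound' | lt = search (suc k) bound' (ℕ.≤-pred lt)

least : ∀ {P : ℕ → Set} → Decidable P → ∀ {k} → P k → ∃[ m ] (P m × ∀ m' → m' < m → ¬ P m')
least P? {zero}  p = 0 , p , λ _ ()
least P? {suc k} p with P? 0
... | yes p0  = 0 , p0 , λ _ ()
... | no  ¬p0 with least (P? ∘ suc) p
...   | m , pm , below = suc m , pm , λ where
        zero     _         → ¬p0
        (suc m') (s≤s m'<m) → below m' m'<m

indicator : ∀ {A : Set} → Dec A → ℕ
indicator (yes _) = 1
indicator (no _)  = 0

indicator-mono : ∀ {A B : Set} → (A → B) → (a? : Dec A) (b? : Dec B) → indicator a? ≤ indicator b?
indicator-mono A→B (yes a) (yes _) = ℕ.≤-refl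
indicator-mono A→B (yes a) (no ¬b) = contradiction (A→B a) ¬b
indicator-mono A→B (no _)  _       = z≤n

indicator-cong : ∀ {A B : Set} → A ⇔ B → (a? : Dec A) (b? : Dec B) → indicator a? ≡ indicator b?
indicator-cong A⇔B (yes _) (yes _) = refl
indicator-cong A⇔B (yes a) (no ¬b) = contradiction (to A⇔B a) ¬b
indicator-cong A⇔B (no ¬a) (yes b) = contradiction (from A⇔B b) ¬a
indicator-cong A⇔B (no _)  (no _)  = refl

indicator-reflects : ∀ {A B : Set} (a? : Dec A) (b? : Dec B) → indicator a? ≡ indicator b? → B → A
indicator-reflects (yes a) _       _  _ = a
indicator-reflects (no _)  (yes _) () _
indicator-reflects (no _)  (no ¬b) _  b = contradiction b ¬b

indicator-resp : ∀ {n} {P : Bits n → Set} → P Respects _≗_ → (P? : Decidable P) →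
                 (indicator ∘ P?) Preserves _≗_ ⟶ _≡_
indicator-resp P-resp P? s≗t = indicator-cong (mk⇔ (P-resp s≗t) (P-resp (sym ∘ s≗t))) (P? _) (P? _)

module Stages {n : ℕ} (e : Fin n → Fm) where

  W[_] : ℕ → Bits n → Set
  W[ k ] = W (stage e k)

  R[_] : ℕ → Bits n → Bits n → Set
  R[ k ] = R (stage e k)

  IsTip-resp : IsTip e Respects _≗_
  IsTip-resp a≗a' tip i with tip i
  ... | ⊥-case , ¬-case , ∨-case =
      (λ eq → trans (sym (a≗a' i)) (⊥-case eq))
    , (λ j eq → trans (sym (a≗a' i)) (trans (¬-case j eq) (cong not (a≗a' j))))
    , (λ j k eq → trans (sym (a≗a' i)) (trans (∨-case j k eq) (cong₂ _∨_ (a≗a' j) (a≗a' k))))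

  mutual
    W-resp : ∀ k → W[ k ] Respects _≗_
    W-resp zero    a≗a' tip            = IsTip-resp a≗a' tip
    W-resp (suc k) a≗a' (wa , refuters) = W-resp k a≗a' wa , λ i j eq a'i →
      let (b , wb , rab , bj) = refuters i j eq (trans (a≗a' i) a'i)
      in b , wb , R-resp k a≗a' (λ _ → refl) rab , bj

    R-resp : ∀ k {a a' b b'} → a ≗ a' → b ≗ b' → R[ k ] a b → R[ k ] a' b'
    R-resp zero    a≗a' b≗b' (ta , tb , boxes) =
      IsTip-resp a≗a' ta , IsTip-resp b≗b' tb ,
      λ i j eq a'i → trans (sym (b≗b' j)) (boxes i j eq (trans (a≗a' i) a'i))
    R-resp (suc k) a≗a' b≗b' (wa , wb , rab , c , wc , rac , rcb) =
      W-resp (suc k) a≗a' wa , W-resp (suc k) b≗b' wb , R-resp k a≗a' b≗b' rab ,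
      c , wc , R-resp k a≗a' (λ _ → refl) rac , R-resp k (λ _ → refl) b≗b' rcb

  W-shrinks : ∀ k {a} → W[ suc k ] a → W[ k ] a
  W-shrinks k = proj₁

  R-shrinks : ∀ k {a b} → R[ suc k ] a b → R[ k ] a b
  R-shrinks k = proj₁ ∘ proj₂ ∘ proj₂

  W-tip : ∀ k {a} → W[ k ] a → IsTip e a
  W-tip zero    = λ tip → tip
  W-tip (suc k) = W-tip k ∘ W-shrinks k

  R-R0 : ∀ k {a b} → R[ k ] a b → R0 e a b
  R-R0 zero    = λ r → r
  R-R0 (suc k) = R-R0 k ∘ R-shrinks k

  IsTip? : Decidable (IsTip e)
  IsTip? a = all? λ i →
         (e i ≟ ⊥' →-dec a i Bool.≟ false)
    ×-dec (all? λ j → e i ≟ ¬' (e j) →-dec a i Bool.≟ not (a j))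
    ×-dec (all? λ j → all? λ k → e i ≟ e j ∨' e k →-dec a i Bool.≟ (a j ∨ a k))

  mutual
    W? : ∀ k → Decidable W[ k ]
    W? zero    = IsTip?
    W? (suc k) a = W? k a ×-dec all? λ i → all? λ j →
      e i ≟ □ (e j) →-dec (a i Bool.≟ false →-dec refuter? k a j)

    R? : ∀ k a → Decidable (R[ k ] a)
    R? zero    a b = IsTip? a ×-dec IsTip? b ×-dec all? λ i → all? λ j →
      e i ≟ □ (e j) →-dec (a i Bool.≟ true →-dec b j Bool.≟ true)
    R? (suc k) a b = W? (suc k) a ×-dec W? (suc k) b ×-dec R? k a b ×-dec midpoint? k a b

    refuter? : ∀ k a j → Dec (∃[ b ] (W[ k ] b × R[ k ] a b × b j ≡ false))
    refuter? k a j = anyBits?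
      (λ b≗b' (wb , rab , bj) → W-resp k b≗b' wb , R-resp k (λ _ → refl) b≗b' rab , trans (sym (b≗b' j)) bj)
      (λ b → W? k b ×-dec R? k a b ×-dec b j Bool.≟ false)

    midpoint? : ∀ k a b → Dec (∃[ c ] (W[ k ] c × R[ k ] a c × R[ k ] c b))
    midpoint? k a b = anyBits?
      (λ c≗c' (wc , rac , rcb) →
         W-resp k c≗c' wc , R-resp k (λ _ → refl) c≗c' rac , R-resp k c≗c' (λ _ → refl) rcb)
      (λ c → W? k c ×-dec R? k a c ×-dec R? k c b)

  W-count : ℕ → Bits n → ℕ
  W-count k a = indicator (W? k a)

  R-count : ℕ → Bits n → Bits n → ℕ
  R-count k a b = indicator (R? k a b)

  size : ℕ → ℕ
  size k = sumBits (W-count k) + sumBits (λ a → sumBits (R-count k a))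

  W-count-anti : ∀ k a → W-count (suc k) a ≤ W-count k a
  W-count-anti k a = indicator-mono (W-shrinks k) (W? (suc k) a) (W? k a)

  R-count-anti : ∀ k a b → R-count (suc k) a b ≤ R-count k a b
  R-count-anti k a b = indicator-mono (R-shrinks k) (R? (suc k) a b) (R? k a b)

  size-anti : ∀ k → size (suc k) ≤ size k
  size-anti k = ℕ.+-mono-≤ (sumBits-mono (W-count-anti k)) (sumBits-mono λ a → sumBits-mono (R-count-anti k a))

  R-count-resp : ∀ k → (λ a → sumBits (R-count k a)) Preserves _≗_ ⟶ _≡_
  R-count-resp k a≗a' = sumBits-cong λ b →
    indicator-cong (mk⇔ (R-resp k a≗a' (λ _ → refl)) (R-resp k (sym ∘ a≗a') (λ _ → refl))) (R? k _ b) (R? k _ b)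

  size-stable : ∀ k → size (suc k) ≡ size k → Stable e k
  size-stable k eq = (λ a → mk⇔ (W-shrinks k) (indicator-reflects (W? (suc k) a) (W? k a) (W-eq a)))
                   , (λ a b → mk⇔ (R-shrinks k) (indicator-reflects (R? (suc k) a b) (R? k a b) (R-eq a b)))
    where
    halves = +-≤-≡-split (sumBits-mono (W-count-anti k)) (sumBits-mono λ a → sumBits-mono (R-count-anti k a)) eq
    W-eq : ∀ a → W-count (suc k) a ≡ W-count k a
    W-eq = sumBits-≤-≡ (indicator-resp (W-resp (suc k)) (W? (suc k))) (indicator-resp (W-resp k) (W? k))
                       (W-count-anti k) (proj₁ halves)
    R-eq : ∀ a b → R-count (suc k) a b ≡ R-count k a b
    R-eq a = sumBits-≤-≡ (indicator-resp (R-resp (suc k) (λ _ → refl)) (R? (suc k) a))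
                         (indicator-resp (R-resp k (λ _ → refl)) (R? k a))
                         (R-count-anti k a)
                         (sumBits-≤-≡ (R-count-resp (suc k)) (R-count-resp k)
                                      (λ a → sumBits-mono (R-count-anti k a)) (proj₂ halves) a)

  stable-size : ∀ k → Stable e k → size (suc k) ≡ size k
  stable-size k (W-same , R-same) =
    cong₂ _+_ (sumBits-cong λ a → indicator-cong (W-same a) (W? (suc k) a) (W? k a))
              (sumBits-cong λ a → sumBits-cong λ b → indicator-cong (R-same a b) (R? (suc k) a b) (R? k a b))

  Stable? : Decidable (Stable e)
  Stable? k = map′ (size-stable k) (stable-size k) (size (suc k) ℕ.≟ size k)

  leastStable : ∃ (IsLeastStable e)
  leastStable with stationary size size-anti
  ... | k , eq = least {Stable e} Stable? {k} (size-stable k eq)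

infixr 6 _∧'_
_∧'_ : Fm → Fm → Fm
a ∧' b = ¬' (¬' a ∨' ¬' b)

⊤' : Fm
⊤' = ¬' ⊥'

private
  variable
    v : Fm → Bool
    A B C : Fm

infix 3.5 _⊨_
record _⊨_ (v : Fm → Bool) (A : Fm) : Set where
  constructor evaluates
  field evaluates-true : evalP v A ≡ true
open _⊨_

not-true : ∀ {x} → not x ≡ true ⇔ x ≢ true
not-true {true}  = mk⇔ (λ ()) (λ x≢true → contradiction refl x≢true)
not-true {false} = mk⇔ (λ _ ()) (λ _ → refl)

implies-true : ∀ {x y} → not x ∨ y ≡ true ⇔ (x ≡ true → y ≡ true)
implies-true {true}  = mk⇔ (λ y≡true _ → y≡true) (λ x→y → x→y refl)
implies-true {false} = mk⇔ (λ _ ()) (λ _ → refl)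

nand-true : ∀ {x y} → not (not x ∨ not y) ≡ true ⇔ (x ≡ true × y ≡ true)
nand-true {true}  {true}  = mk⇔ (λ _ → refl , refl) (λ _ → refl)
nand-true {true}  {false} = mk⇔ (λ ()) (λ ())
nand-true {false}         = mk⇔ (λ ()) (λ ())

⊨¬-intro : ¬ (v ⊨ A) → v ⊨ ¬' A
⊨¬-intro ⊭A = evaluates (from not-true (⊭A ∘ evaluates))

⊨¬-elim : v ⊨ ¬' A → ¬ (v ⊨ A)
⊨¬-elim (evaluates ⊨¬A) (evaluates ⊨A) = to not-true ⊨¬A ⊨A

⊨⇒-intro : (v ⊨ A → v ⊨ B) → v ⊨ A ⇒ B
⊨⇒-intro ⊨A→⊨B = evaluates (from implies-true (evaluates-true ∘ ⊨A→⊨B ∘ evaluates))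

⊨⇒-elim : v ⊨ A ⇒ B → v ⊨ A → v ⊨ B
⊨⇒-elim (evaluates ⊨A⇒B) (evaluates ⊨A) = evaluates (to implies-true ⊨A⇒B ⊨A)

⊨∧-intro : v ⊨ A → v ⊨ B → v ⊨ A ∧' B
⊨∧-intro (evaluates ⊨A) (evaluates ⊨B) = evaluates (from nand-true (⊨A , ⊨B))

⊨∧-elim : v ⊨ A ∧' B → v ⊨ A × v ⊨ B
⊨∧-elim (evaluates ⊨A∧B) = let (⊨A , ⊨B) = to nand-true ⊨A∧B in evaluates ⊨A , evaluates ⊨B

tautology : (∀ v → v ⊨ A) → KDe A
tautology ⊨A = taut (evaluates-true ∘ ⊨A)

consequence : ∀ {B} (hs : List Fm) → All KDe hs → (∀ v → All (v ⊨_) hs → v ⊨ B) → KDe B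
consequence []       []         sem = tautology λ v → sem v []
consequence (h ∷ hs) (⊢h ∷ ⊢hs) sem = mp (consequence hs ⊢hs λ v ⊨hs → ⊨⇒-intro λ ⊨h → sem v (⊨h ∷ ⊨hs)) ⊢h

⇒-weaken : KDe B → KDe (A ⇒ B)
⇒-weaken ⊢B = consequence (_ ∷ []) (⊢B ∷ []) λ { v (⊨B ∷ []) → ⊨⇒-intro λ _ → ⊨B }

⇒-trans : KDe (A ⇒ B) → KDe (B ⇒ C) → KDe (A ⇒ C)
⇒-trans ⊢A⇒B ⊢B⇒C = consequence (_ ∷ _ ∷ []) (⊢A⇒B ∷ ⊢B⇒C ∷ [])
  λ { v (⊨A⇒B ∷ ⊨B⇒C ∷ []) → ⊨⇒-intro (⊨⇒-elim ⊨B⇒C ∘ ⊨⇒-elim ⊨A⇒B) }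

¬-⇒ : KDe (¬' A ⇒ (A ⇒ B))
¬-⇒ = tautology λ v → ⊨⇒-intro λ ⊨¬A → ⊨⇒-intro λ ⊨A → contradiction ⊨A (⊨¬-elim ⊨¬A)

⇒-refute : KDe (A ⇒ B) → KDe (A ⇒ ¬' B) → KDe (¬' A)
⇒-refute ⊢A⇒B ⊢A⇒¬B = consequence (_ ∷ _ ∷ []) (⊢A⇒B ∷ ⊢A⇒¬B ∷ [])
  λ { v (⊨A⇒B ∷ ⊨A⇒¬B ∷ []) → ⊨¬-intro λ ⊨A → ⊨¬-elim (⊨⇒-elim ⊨A⇒¬B ⊨A) (⊨⇒-elim ⊨A⇒B ⊨A) }

contraposition : KDe (A ⇒ ¬' B) → KDe (B ⇒ ¬' A)
contraposition ⊢A⇒¬B = consequence (_ ∷ []) (⊢A⇒¬B ∷ [])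
  λ { v (⊨A⇒¬B ∷ []) → ⊨⇒-intro λ ⊨B → ⊨¬-intro λ ⊨A → ⊨¬-elim (⊨⇒-elim ⊨A⇒¬B ⊨A) ⊨B }

∧-intro : KDe A → KDe B → KDe (A ∧' B)
∧-intro ⊢A ⊢B = consequence (_ ∷ _ ∷ []) (⊢A ∷ ⊢B ∷ []) λ { v (⊨A ∷ ⊨B ∷ []) → ⊨∧-intro ⊨A ⊨B }

□-mono : KDe (A ⇒ B) → KDe (□ A ⇒ □ B)
□-mono ⊢A⇒B = mp axK (nec ⊢A⇒B)

□-∧ : KDe (□ A ⇒ (□ B ⇒ □ (A ∧' B)))
□-∧ = ⇒-trans (□-mono (tautology λ v → ⊨⇒-intro λ ⊨A → ⊨⇒-intro λ ⊨B → ⊨∧-intro ⊨A ⊨B)) axK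

⇒□-∧ : KDe (C ⇒ □ A) → KDe (C ⇒ □ B) → KDe (C ⇒ □ (A ∧' B))
⇒□-∧ ⊢C⇒□A ⊢C⇒□B = consequence (_ ∷ _ ∷ _ ∷ []) (⊢C⇒□A ∷ ⊢C⇒□B ∷ □-∧ ∷ [])
  λ { v (⊨C⇒□A ∷ ⊨C⇒□B ∷ ⊨□-∧ ∷ []) →
        ⊨⇒-intro λ ⊨C → ⊨⇒-elim (⊨⇒-elim ⊨□-∧ (⊨⇒-elim ⊨C⇒□A ⊨C)) (⊨⇒-elim ⊨C⇒□B ⊨C) }

⋀Bits : ∀ {n} → (Bits n → Fm) → Fm
⋀Bits = foldBits _∧'_

⋀Bits-intro : ∀ {n} {f : Bits n → Fm} → (∀ t → KDe (f t)) → KDe (⋀Bits f)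
⋀Bits-intro = foldBits-intro _∧'_ KDe ∧-intro

⇒□-⋀Bits : ∀ {n} {f : Bits n → Fm} → (∀ t → KDe (A ⇒ □ (f t))) → KDe (A ⇒ □ (⋀Bits f))
⇒□-⋀Bits {A = A} = foldBits-intro _∧'_ (λ B → KDe (A ⇒ □ B)) ⇒□-∧

⊨⋀Bits-elim : ∀ {n} {f : Bits n → Fm} → f Preserves _≗_ ⟶ _≡_ → v ⊨ ⋀Bits f → ∀ t → v ⊨ f t
⊨⋀Bits-elim {v = v} = foldBits-elim _∧'_ (v ⊨_) ⊨∧-elim

⋀ : ∀ {n} → Vector Fm n → Fm
⋀ = foldr _∧'_ ⊤'

⋀-cong : ∀ {n} {f g : Vector Fm n} → f ≗ g → ⋀ f ≡ ⋀ g
⋀-cong {zero}  f≗g = refl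
⋀-cong {suc n} f≗g = cong₂ _∧'_ (f≗g zero) (⋀-cong (f≗g ∘ suc))

⊨⋀ : ∀ {n} {v} {f : Vector Fm n} → v ⊨ ⋀ f ⇔ (∀ i → v ⊨ f i)
⊨⋀ {n} {v} = mk⇔ (elim n) (intro n)
  where
  elim : ∀ n {f : Vector Fm n} → v ⊨ ⋀ f → ∀ i → v ⊨ f i
  elim (suc n) ⊨⋀f zero    = proj₁ (⊨∧-elim ⊨⋀f)
  elim (suc n) ⊨⋀f (suc i) = elim n (proj₂ (⊨∧-elim ⊨⋀f)) i
  intro : ∀ n {f : Vector Fm n} → (∀ i → v ⊨ f i) → v ⊨ ⋀ f
  intro zero    ⊨f = evaluates refl
  intro (suc n) ⊨f = ⊨∧-intro (⊨f zero) (intro n (⊨f ∘ suc))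

literal : Bool → Fm → Fm
literal true  a = a
literal false a = ¬' a

⊨literal : ∀ x A → v ⊨ literal x A ⇔ evalP v A ≡ x
⊨literal true  A = mk⇔ evaluates-true evaluates
⊨literal false A = mk⇔ (λ ⊨¬A → ¬-not (⊨¬-elim ⊨¬A ∘ evaluates))
                       (λ A≡false → ⊨¬-intro λ ⊨A → not-¬ A≡false (evaluates-true ⊨A))

-- Completeness

¬→-split : ∀ {P Q : Set} → Dec P → ¬ (P → Q) → P × ¬ Q
¬→-split (yes p) ¬[p→q] = p , λ q → ¬[p→q] λ _ → q
¬→-split (no ¬p) ¬[p→q] = contradiction (λ p → contradiction p ¬p) ¬[p→q]

module Completeness {n : ℕ} (e : Fin n → Fm) where
  open Stages e

  χ : Bits n → Fm
  χ a = ⋀ λ i → literal (a i) (e i)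

  χ-resp : χ Preserves _≗_ ⟶ _≡_
  χ-resp a≗a' = ⋀-cong λ i → cong (λ x → literal x (e i)) (a≗a' i)

  ⊨χ : ∀ {a} → v ⊨ χ a ⇔ (∀ i → evalP v (e i) ≡ a i)
  ⊨χ = mk⇔ (λ ⊨χa i → to (⊨literal _ _) (to ⊨⋀ ⊨χa i)) (λ v≗a → from ⊨⋀ λ i → from (⊨literal _ _) (v≗a i))

  evaluation : (Fm → Bool) → Bits n
  evaluation v i = evalP v (e i)

  evaluation-tip : ∀ v → IsTip e (evaluation v)
  evaluation-tip v i = cong (evalP v) , (λ j → cong (evalP v)) , (λ j k → cong (evalP v))

  χ⇒literal : ∀ a i → KDe (χ a ⇒ literal (a i) (e i))
  χ⇒literal a i = tautology λ v → ⊨⇒-intro λ ⊨χa → from (⊨literal _ _) (to ⊨χ ⊨χa i)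

  χ⇒ψ : ∀ {a i} → a i ≡ true → KDe (χ a ⇒ e i)
  χ⇒ψ {a} {i} ai = subst (λ x → KDe (χ a ⇒ literal x (e i))) ai (χ⇒literal a i)

  χ⇒¬ψ : ∀ {a i} → a i ≡ false → KDe (χ a ⇒ ¬' (e i))
  χ⇒¬ψ {a} {i} ai = subst (λ x → KDe (χ a ⇒ literal x (e i))) ai (χ⇒literal a i)

  χ-cover : ∀ A → KDe (⋀Bits (λ a → χ a ⇒ A) ⇒ A)
  χ-cover A = tautology λ v → ⊨⇒-intro λ ⊨cases →
    ⊨⇒-elim (⊨⋀Bits-elim (cong (_⇒ A) ∘ χ-resp) ⊨cases (evaluation v)) (from ⊨χ λ _ → refl)

  χ-exhaustive : (∀ a → KDe (χ a ⇒ A)) → KDe A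
  χ-exhaustive = mp (χ-cover _) ∘ ⋀Bits-intro

  ⇒□-cover : (∀ c → KDe (A ⇒ □ (¬' (χ c))) ⊎ KDe (χ c ⇒ B)) → KDe (A ⇒ □ B)
  ⇒□-cover cases =
    ⇒-trans (⇒□-⋀Bits λ c → [ (λ ⊢A⇒□¬χc → ⇒-trans ⊢A⇒□¬χc (□-mono ¬-⇒)) , ⇒-weaken ∘ nec ] (cases c))
            (□-mono (χ-cover _))

  nonTip-refuted : ∀ {a} → ¬ IsTip e a → KDe (¬' (χ a))
  nonTip-refuted ¬tip = tautology λ v → ⊨¬-intro λ ⊨χa → ¬tip (IsTip-resp (to ⊨χ ⊨χa) (evaluation-tip v))

  module _ {a : Bits n} {x : Bool} {Q : Fin n → Set} (Q? : Decidable Q) where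

    BoxAt : Fin n → Fin n → Set
    BoxAt i j = e i ≡ □ (e j) → a i ≡ x → Q j

    BoxAt? : ∀ i j → Dec (BoxAt i j)
    BoxAt? i j = e i ≟ □ (e j) →-dec (a i Bool.≟ x →-dec Q? j)

    box-counterexample : ¬ (∀ i j → BoxAt i j) → ∃[ i ] ∃[ j ] (e i ≡ □ (e j) × a i ≡ x × ¬ Q j)
    box-counterexample ¬boxes
      with i , ¬at-i  ← ¬∀⟶∃¬ n (λ i → ∀ j → BoxAt i j) (λ i → all? (BoxAt? i)) ¬boxes
      with j , ¬at-ij ← ¬∀⟶∃¬ n (BoxAt i) (BoxAt? i) ¬at-i
      with ei≡□ej , ¬rest ← ¬→-split (e i ≟ □ (e j)) ¬at-ij
      with ai≡x , ¬Qj ← ¬→-split (a i Bool.≟ x) ¬rest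
      = i , j , ei≡□ej , ai≡x , ¬Qj

  W-complement-refuted : ℕ → Set
  W-complement-refuted k = ∀ a → ¬ W[ k ] a → KDe (¬' (χ a))

  R-complement-refuted : ℕ → Set
  R-complement-refuted k = ∀ a b → ¬ R[ k ] a b → KDe (χ a ⇒ □ (¬' (χ b)))

  R0-complement-refuted : R-complement-refuted 0
  R0-complement-refuted a b ¬R0 with IsTip? a | IsTip? b
  ... | no ¬ta | _      = mp ¬-⇒ (nonTip-refuted ¬ta)
  ... | yes _  | no ¬tb = ⇒-weaken (nec (nonTip-refuted ¬tb))
  ... | yes ta | yes tb
    with i , j , ei≡□ej , ai , ¬bj ← box-counterexample (λ j → b j Bool.≟ true) (λ boxes → ¬R0 (ta , tb , boxes))
    = ⇒-trans (subst (λ A → KDe (χ a ⇒ A)) ei≡□ej (χ⇒ψ ai)) (□-mono (contraposition (χ⇒¬ψ (¬-not ¬bj))))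

  module _ (k : ℕ) (¬W⊢ : W-complement-refuted k) (¬R⊢ : R-complement-refuted k) where

    ⇒□-successors : ∀ a → (∀ c → W[ k ] c → R[ k ] a c → KDe (χ c ⇒ A)) → KDe (χ a ⇒ □ A)
    ⇒□-successors a successors = ⇒□-cover cases
      where
      cases : ∀ c → KDe (χ a ⇒ □ (¬' (χ c))) ⊎ KDe (χ c ⇒ _)
      cases c with W? k c | R? k a c
      ... | no ¬wc | _        = inj₂ (mp ¬-⇒ (¬W⊢ c ¬wc))
      ... | yes _  | no ¬rac  = inj₁ (¬R⊢ a c ¬rac)
      ... | yes wc | yes rac  = inj₂ (successors c wc rac)

    W-step : W-complement-refuted (suc k)
    W-step a ¬Wa with W? k a
    ... | no ¬wa = ¬W⊢ a ¬wa
    ... | yes wa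
      with i , j , ei≡□ej , ai , no-refuter ← box-counterexample (refuter? k a) (λ refuters → ¬Wa (wa , refuters))
      = ⇒-refute (⇒□-successors a λ c wc rac → χ⇒ψ (¬-not λ cj → no-refuter (c , wc , rac , cj)))
                 (subst (λ A → KDe (χ a ⇒ ¬' A)) ei≡□ej (χ⇒¬ψ ai))

    R-step : R-complement-refuted (suc k)
    R-step a b ¬Rab with W? (suc k) a | W? (suc k) b | R? k a b | midpoint? k a b
    ... | no ¬wa | _      | _       | _       = mp ¬-⇒ (W-step a ¬wa)
    ... | yes _  | no ¬wb | _       | _       = ⇒-weaken (nec (W-step b ¬wb))
    ... | yes _  | yes _  | no ¬rab | _       = ¬R⊢ a b ¬rab
    ... | yes wa | yes wb | yes rab | yes mid = contradiction (wa , wb , rab , mid) ¬Rab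
    ... | yes _  | yes _  | yes _   | no ¬mid =
      ⇒-trans (⇒□-successors a λ c wc rac → ¬R⊢ c b λ rcb → ¬mid (c , wc , rac , rcb)) axDe

  complement-refuted : ∀ k → W-complement-refuted k × R-complement-refuted k
  complement-refuted zero    = (λ a → nonTip-refuted) , R0-complement-refuted
  complement-refuted (suc k) = let (¬W⊢ , ¬R⊢) = complement-refuted k in W-step k ¬W⊢ ¬R⊢ , R-step k ¬W⊢ ¬R⊢

  completeness : ∀ k i → (∀ a → W[ k ] a → a i ≡ true) → KDe (e i)
  completeness k i valid = χ-exhaustive λ a → case W? k a of λ where
    (yes wa) → χ⇒ψ (valid a wa)
    (no ¬wa) → mp ¬-⇒ (proj₁ (complement-refuted k) a ¬wa)

-- Soundness

module FiniteModel {n : ℕ}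
  (_↝_ : Bits n → Bits n → Set) (_↝?_ : ∀ a b → Dec (a ↝ b))
  (↝-resp : ∀ {a a' b b'} → a ≗ a' → b ≗ b' → a ↝ b → a' ↝ b')
  (atom : ℕ → Bits n → Bool) (atom-resp : ∀ p → atom p Preserves _≗_ ⟶ _≡_)
  where

  sat : Bits n → Fm → Bool
  sat a (var p)  = atom p a
  sat a ⊥'       = false
  sat a (¬' A)   = not (sat a A)
  sat a (A ∨' B) = sat a A ∨ sat a B
  sat a (□ A)    = allBits λ b → not (does (a ↝? b)) ∨ sat b A

  sat-valuation : ∀ a A → evalP (sat a) A ≡ sat a A
  sat-valuation a (var p)  = refl
  sat-valuation a ⊥'       = refl
  sat-valuation a (¬' A)   = cong not (sat-valuation a A)
  sat-valuation a (A ∨' B) = cong₂ _∨_ (sat-valuation a A) (sat-valuation a B)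
  sat-valuation a (□ A)    = refl

  ↝?-resp : ∀ {a a' b b'} → a ≗ a' → b ≗ b' → does (a ↝? b) ≡ does (a' ↝? b')
  ↝?-resp {a} {a'} {b} {b'} a≗a' b≗b' =
    does-⇔ (mk⇔ (↝-resp a≗a' b≗b') (↝-resp (sym ∘ a≗a') (sym ∘ b≗b'))) (a ↝? b) (a' ↝? b')

  sat-resp : ∀ A → (λ a → sat a A) Preserves _≗_ ⟶ _≡_
  sat-resp (var p)  a≗a' = atom-resp p a≗a'
  sat-resp ⊥'       a≗a' = refl
  sat-resp (¬' A)   a≗a' = cong not (sat-resp A a≗a')
  sat-resp (A ∨' B) a≗a' = cong₂ _∨_ (sat-resp A a≗a') (sat-resp B a≗a')
  sat-resp (□ A)    a≗a' = foldBits-rel _∧_ _≡_ (cong₂ _∧_) λ b →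
    cong (λ x → not x ∨ sat b A) (↝?-resp a≗a' λ _ → refl)

  ⊨□ : ∀ {a A} → sat a ⊨ □ A ⇔ (∀ b → a ↝ b → sat b ⊨ A)
  ⊨□ {a} {A} = mk⇔ elim intro
    where
    holds⇔ : ∀ b → sat b ⊨ A ⇔ sat b A ≡ true
    holds⇔ b = mk⇔ (trans (sym (sat-valuation b A)) ∘ evaluates-true) (evaluates ∘ trans (sat-valuation b A))
    elim : sat a ⊨ □ A → ∀ b → a ↝ b → sat b ⊨ A
    elim (evaluates ⊨□A) b a↝b = from (holds⇔ b) $
      to implies-true
        (allBits-elim (λ b≗b' → cong₂ (λ x y → not x ∨ y) (↝?-resp (λ _ → refl) b≗b') (sat-resp A b≗b')) ⊨□A b)
        (dec-true (a ↝? b) a↝b)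
    intro : (∀ b → a ↝ b → sat b ⊨ A) → sat a ⊨ □ A
    intro ⊨A = evaluates (allBits-intro λ b → box-at b (a ↝? b))
      where
      box-at : ∀ b (a↝?b : Dec (a ↝ b)) → not (does a↝?b) ∨ sat b A ≡ true
      box-at b (yes a↝b) = to (holds⇔ b) (⊨A b a↝b)
      box-at b (no _)    = refl

  Dense : Set
  Dense = ∀ {a b} → a ↝ b → ∃[ c ] (a ↝ c × c ↝ b)

  soundness : Dense → KDe A → ∀ a → sat a ⊨ A
  soundness dense (taut ⊨A)  a = evaluates (⊨A (sat a))
  soundness dense axK        a = ⊨⇒-intro λ ⊨□A⇒B → ⊨⇒-intro λ ⊨□A →
    from ⊨□ λ b a↝b → ⊨⇒-elim (to ⊨□ ⊨□A⇒B b a↝b) (to ⊨□ ⊨□A b a↝b)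
  soundness dense axDe       a = ⊨⇒-intro λ ⊨□□A → from ⊨□ λ b a↝b →
    let (c , a↝c , c↝b) = dense a↝b in to ⊨□ (to ⊨□ ⊨□□A c a↝c) b c↝b
  soundness dense (mp ⊢A⇒B ⊢A) a = ⊨⇒-elim (soundness dense ⊢A⇒B a) (soundness dense ⊢A a)
  soundness dense (nec ⊢A)   a = from ⊨□ λ b _ → soundness dense ⊢A b

-- The truth lemma at a fixed point

module Enumeration {φ : Fm} {n : ℕ} {e : Fin n → Fm} (enum : IsEnum φ e) where
  open IsEnum enum

  subformula-index : ∀ {i A B} → e i ≡ B → A ≼ B → ∃[ j ] e j ≡ A
  subformula-index {i} ei≡B A≼B = complete _ (≼-trans A≼B (subst (_≼ φ) ei≡B (sound i)))

  ¬-child : ∀ {i A} → e i ≡ ¬' A → ∃[ j ] (e j ≡ A × e i ≡ ¬' (e j))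
  ¬-child ei with j , ej ← subformula-index ei (in¬ here) = j , ej , trans ei (cong ¬' (sym ej))

  □-child : ∀ {i A} → e i ≡ □ A → ∃[ j ] (e j ≡ A × e i ≡ □ (e j))
  □-child ei with j , ej ← subformula-index ei (in□ here) = j , ej , trans ei (cong □ (sym ej))

  ∨-children : ∀ {i A B} → e i ≡ A ∨' B → ∃[ j ] ∃[ j' ] (e j ≡ A × e j' ≡ B × e i ≡ e j ∨' e j')
  ∨-children ei with j , ej ← subformula-index ei (in∨ˡ here) | j' , ej' ← subformula-index ei (in∨ʳ here) =
    j , j' , ej , ej' , trans ei (cong₂ _∨'_ (sym ej) (sym ej'))

  index-mono : ∀ {A B} → A ≼ B → ∀ {i j} → e i ≡ A → e j ≡ B → i Fin.≤ j
  index-mono here ei ej = Fin.≤-reflexive (injective (trans ei (sym ej)))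
  index-mono (in¬ A≼B) ei ej with _ , ej' , ej≡¬ ← ¬-child ej =
    Fin.≤-trans (index-mono A≼B ei ej') (ℕ.<⇒≤ (ord¬ _ _ ej≡¬))
  index-mono (in□ A≼B) ei ej with _ , ej' , ej≡□ ← □-child ej =
    Fin.≤-trans (index-mono A≼B ei ej') (ℕ.<⇒≤ (ord□ _ _ ej≡□))
  index-mono (in∨ˡ A≼B) ei ej with _ , _ , ej₁ , _ , ej≡∨ ← ∨-children ej =
    Fin.≤-trans (index-mono A≼B ei ej₁) (ℕ.<⇒≤ (proj₁ (ord∨ _ _ _ ej≡∨)))
  index-mono (in∨ʳ A≼B) ei ej with _ , _ , _ , ej₂ , ej≡∨ ← ∨-children ej =
    Fin.≤-trans (index-mono A≼B ei ej₂) (ℕ.<⇒≤ (proj₂ (ord∨ _ _ _ ej≡∨)))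

last-is-φ : ∀ {φ m} {e : Fin (suc m) → Fm} → IsEnum φ e → e (fromℕ m) ≡ φ
last-is-φ {φ} {m} {e} enum with i , ei≡φ ← IsEnum.complete enum φ here =
  subst (λ j → e j ≡ φ) (Fin.≤-antisym (Fin.≤fromℕ i) (index-mono (IsEnum.sound enum (fromℕ m)) refl ei≡φ)) ei≡φ
  where open Enumeration enum

module Truth {φ : Fm} {n : ℕ} {e : Fin n → Fm} (enum : IsEnum φ e) (k : ℕ) (stable : Stable e k) where
  open IsEnum enum
  open Enumeration enum
  open Stages e

  _↝_ : Bits n → Bits n → Set
  a ↝ b = W[ k ] b × R[ k ] a b

  _↝?_ : ∀ a b → Dec (a ↝ b)
  a ↝? b = W? k b ×-dec R? k a b

  ↝-resp : ∀ {a a' b b'} → a ≗ a' → b ≗ b' → a ↝ b → a' ↝ b'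
  ↝-resp a≗a' b≗b' (wb , rab) = W-resp k b≗b' wb , R-resp k a≗a' b≗b' rab

  occurs? : ∀ p (a : Bits n) → Dec (∃[ i ] (e i ≡ var p × a i ≡ true))
  occurs? p a = any? λ i → e i ≟ var p ×-dec a i Bool.≟ true

  atom : ℕ → Bits n → Bool
  atom p a = does (occurs? p a)

  atom-resp : ∀ p → atom p Preserves _≗_ ⟶ _≡_
  atom-resp p {a} {a'} a≗a' = does-⇔ (mk⇔ (λ (i , ei , ai) → i , ei , trans (sym (a≗a' i)) ai)
                                          (λ (i , ei , ai) → i , ei , trans (a≗a' i) ai))
                                     (occurs? p a) (occurs? p a')

  open FiniteModel _↝_ _↝?_ ↝-resp atom atom-resp

  dense : Dense
  dense (wb , rab) with _ , _ , _ , c , wc , rac , rcb ← from (proj₂ stable _ _) rab =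
    c , (wc , rac) , (wb , rcb)

  truth : ∀ A {i} → e i ≡ A → ∀ {a} → W[ k ] a → evalP (sat a) A ≡ a i
  truth (var p) {i} ei {a} wa with a i in ai
  ... | true  = dec-true (occurs? p a) (i , ei , ai)
  ... | false = dec-false (occurs? p a) λ (i' , ei' , ai') →
                  not-¬ ai (trans (cong a (injective (trans ei (sym ei')))) ai')
  truth ⊥' {i} ei wa with ⊥-case , _ ← W-tip k wa i = sym (⊥-case ei)
  truth (¬' A) {i} ei wa with j , ej , ei≡¬ej ← ¬-child ei | _ , ¬-case , _ ← W-tip k wa i =
    trans (cong not (truth A ej wa)) (sym (¬-case j ei≡¬ej))
  truth (A ∨' B) {i} ei wa with j , j' , ej , ej' , ei≡∨ ← ∨-children ei | _ , _ , ∨-case ← W-tip k wa i =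
    trans (cong₂ _∨_ (truth A ej wa) (truth B ej' wa)) (sym (∨-case j j' ei≡∨))
  truth (□ A) {i} ei {a} wa with j , ej , ei≡□ej ← □-child ei | a i in ai
  ... | true  = evaluates-true $ from (⊨□ {a} {A}) λ b (wb , rab) →
                  let (_ , _ , boxes) = R-R0 k rab in evaluates (trans (truth A ej wb) (boxes i j ei≡□ej ai))
  ... | false with b , wb , rab , bj ← proj₂ (from (proj₁ stable a) wa) i j ei≡□ej ai =
    ¬-not λ ⊨□A →
      not-¬ bj (trans (sym (truth A ej wb)) (evaluates-true (to (⊨□ {a} {A}) (evaluates ⊨□A) b (wb , rab))))

  valid-on-stage : ∀ {i} → KDe (e i) → ∀ a → W[ k ] a → a i ≡ true
  valid-on-stage {i} ⊢ψ a wa = trans (sym (truth (e i) refl wa)) (evaluates-true (soundness dense ⊢ψ a))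

lemma10 : (φ : Fm) (m : ℕ) (e : Fin (suc m) → Fm) → IsEnum φ e →
    ∃[ k ] (IsLeastStable e k ×
            (KDe φ ⇔ (∀ a → W (stage e k) a → a (fromℕ m) ≡ true)))
lemma10 φ m e enum = k , k-least , mk⇔
    (λ ⊢φ → Truth.valid-on-stage enum k (proj₁ k-least) (subst KDe (sym φ-last) ⊢φ))
    (λ valid → subst KDe φ-last (Completeness.completeness e k (fromℕ m) valid))
  where
  k : ℕ
  k = proj₁ (Stages.leastStable e)
  k-least : IsLeastStable e k
  k-least = proj₂ (Stages.leastStable e)
  φ-last : e (fromℕ m) ≡ φ
  φ-last = last-is-φ enum
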